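{- For every dealing pattern $P$ and positive integers $k,N$ with $N\ge M^P(k)$, we have $J^P_{N,k}=M^P(k)=d_k(P)$; in particular $J^P_{N,k}$ does not depend on $N$ for $N\ge d_k(P)$.
   Context: A dealing pattern $P=P_1P_2P_3\cdots$ is an infinite sequence of letters $U$ and $D$ containing infinitely many $D$'s. Dealing a deck of $N$ cards (positions $1,\dots,N$ from the top) by $P$ means: process the letters in order; for a $U$ move the top card to the bottom; for a $D$ remove the top card (deal it); stop when all $N$ cards are dealt. $M^P(k)$ is the total number of letters processed when dealing $k$ cards by $P$. $J^P_{N,k}$ ($1\le k\le N$) is the initial position of the $k$th card dealt from a deck of $N$ cards. $d_k(P)$ is the index (starting from 1) of the $k$th occurrence of $D$ in $P$. -}

module Defs where

open import Data.Nat using (ℕ; zero; suc; _≤_; _<_; _∸_)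
open import Data.List using (List; []; _∷_; _++_; [_]; map; upTo)
open import Data.Maybe using (Maybe; just; nothing)
open import Data.Product using (_×_; _,_; proj₁; proj₂; ∃-syntax)
open import Relation.Binary.PropositionalEquality using (_≡_; _≢_)

data Letter : Set where
  U D : Letter

-- A pattern P = P₁P₂P₃⋯ is represented by a function with  P i = P_{i+1}
-- (0-based indexing of the function; the paper's indices are 1-based).
Pattern : Set
Pattern = ℕ → Letter

InfinitelyManyD : Pattern → Set
InfinitelyManyD P = ∀ n → ∃[ m ] (n ≤ m × P m ≡ D)

-- State of the dealing process: (current deck top-to-bottom, cards dealt so far in order)
State : Set
State = List ℕ × List ℕ

step : Letter → State → State
step _ ([] , ds)     = [] , ds
step U (x ∷ xs , ds) = xs ++ [ x ] , ds
step D (x ∷ xs , ds) = xs , ds ++ [ x ]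

initDeck : ℕ → List ℕ
initDeck N = map suc (upTo N)

-- state after processing the first t letters P₁⋯P_t on a deck of N cards
-- (once the deck is empty the process has stopped; further letters do nothing)
stateAfter : Pattern → ℕ → ℕ → State
stateAfter P N zero    = initDeck N , []
stateAfter P N (suc t) = step (P t) (stateAfter P N t)

deckAfter : Pattern → ℕ → ℕ → List ℕ
deckAfter P N t = proj₁ (stateAfter P N t)

dealtAfter : Pattern → ℕ → ℕ → List ℕ
dealtAfter P N t = proj₂ (stateAfter P N t)

-- IsM P k m :  M^P(k) = m, i.e. m is the number of letters processed when
-- dealing a deck of k cards by P (least t after which the deck is empty)
IsM : Pattern → ℕ → ℕ → Set
IsM P k m = deckAfter P k m ≡ [] × (∀ t → t < m → deckAfter P k t ≢ [])

nth : {A : Set} → List A → ℕ → Maybe A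
nth []       _       = nothing
nth (x ∷ xs) zero    = just x
nth (x ∷ xs) (suc i) = nth xs i

-- IsJ P N k j :  J^P_{N,k} = j, i.e. the k-th card dealt (k ≥ 1) from a deck of
-- N cards has initial position j
IsJ : Pattern → ℕ → ℕ → ℕ → Set
IsJ P N k j = ∃[ t ] (nth (dealtAfter P N t) (k ∸ 1) ≡ just j)

countD : Pattern → ℕ → ℕ
countD P zero    = zero
countD P (suc n) with P n
... | U = countD P n
... | D = suc (countD P n)

-- IsD P k d :  d_k(P) = d, i.e. P_d = D and P₁⋯P_d contains exactly k D's
IsD : Pattern → ℕ → ℕ → Set
IsD P k d = 1 ≤ d × P (d ∸ 1) ≡ D × countD P d ≡ k

{-# OPTIONS --safe #-}
-- As long as the deck of N cards is not exhausted, the t-th letter acts on the card at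
-- initial position t: every earlier letter moved its own top card either out or to the
-- bottom, behind the untouched cards t, …, N. Counting cards, the number dealt after
-- t letters is the number of D's among them; so dealing k cards stops exactly at the
-- k-th D (a U never empties a deck), i.e. M(k) = d_k. In a deck of N ≥ d_k cards the
-- letter P_{d_k} = D then deals card d_k, and it is the k-th card dealt.
module Submission where

open import Defs
open import Data.Nat using (ℕ; _≤_; zero; suc; _+_; _<_; _∸_; s≤s; z≤n)
open import Data.Nat.Properties using (+-suc; +-identityʳ; ≤-refl; <⇒≤; <-trans; n<1+n; m<n⇒m<1+n)
open import Data.Product using (_×_; _,_; proj₁; proj₂; ∃-syntax)
open import Data.List using (List; []; _∷_; _++_; [_]; map; upTo; applyUpTo; length; drop)
open import Data.List.Properties using (++-assoc; ++-identityʳ; length-map; length-upTo; drop-map)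
open import Data.Maybe using (just)
open import Function using (id)
open import Relation.Binary.PropositionalEquality
  using (_≡_; _≢_; refl; sym; trans; cong; cong₂; module ≡-Reasoning)
open import Relation.Nullary using (contradiction)

private
  variable
    P : Pattern
    N k t : ℕ

length-∷ʳ : {A : Set} (xs : List A) (x : A) → length (xs ++ [ x ]) ≡ suc (length xs)
length-∷ʳ []       x = refl
length-∷ʳ (_ ∷ xs) x = cong suc (length-∷ʳ xs x)

nth-∷ʳ : {A : Set} (xs : List A) (x : A) → nth (xs ++ [ x ]) (length xs) ≡ just x
nth-∷ʳ []       x = refl
nth-∷ʳ (_ ∷ xs) x = nth-∷ʳ xs x

drop-applyUpTo : {A : Set} (f : ℕ → A) → t < N →
  drop t (applyUpTo f N) ≡ f t ∷ drop (suc t) (applyUpTo f N)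
drop-applyUpTo {t = zero}  {suc N} f _         = refl
drop-applyUpTo {t = suc t} {suc N} f (s≤s t<N) = drop-applyUpTo (λ i → f (suc i)) t<N

drop-initDeck : t < N → drop t (initDeck N) ≡ suc t ∷ drop (suc t) (initDeck N)
drop-initDeck {t} {N} t<N = begin
  drop t (map suc (upTo N))                ≡⟨ drop-map t (upTo N) ⟩
  map suc (drop t (upTo N))                ≡⟨ cong (map suc) (drop-applyUpTo id t<N) ⟩
  suc t ∷ map suc (drop (suc t) (upTo N))  ≡⟨ cong (suc t ∷_) (sym (drop-map (suc t) (upTo N))) ⟩
  suc t ∷ drop (suc t) (initDeck N)        ∎
  where open ≡-Reasoning

dCount : Letter → ℕ
dCount U = 0
dCount D = 1

countD-suc : ∀ P n → countD P (suc n) ≡ dCount (P n) + countD P n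
countD-suc P n with P n
... | U = refl
... | D = refl

length-step : ∀ l (s : State) →
  length (proj₁ (step l s)) + length (proj₂ (step l s)) ≡ length (proj₁ s) + length (proj₂ s)
length-step l ([] , ds)     = refl
length-step U (x ∷ xs , ds) = cong (_+ length ds) (length-∷ʳ xs x)
length-step D (x ∷ xs , ds) = trans (cong (length xs +_) (length-∷ʳ ds x)) (+-suc (length xs) (length ds))

length-stateAfter : ∀ P N t → length (deckAfter P N t) + length (dealtAfter P N t) ≡ N
length-stateAfter P N zero    =
  trans (+-identityʳ _) (trans (length-map suc (upTo N)) (length-upTo N))
length-stateAfter P N (suc t) =
  trans (length-step (P t) (stateAfter P N t)) (length-stateAfter P N t)

length-dealt-step : ∀ l (s : State) → proj₁ s ≢ [] →
  length (proj₂ (step l s)) ≡ dCount l + length (proj₂ s)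
length-dealt-step l ([] , ds)     nonempty = contradiction refl nonempty
length-dealt-step U (x ∷ xs , ds) _        = refl
length-dealt-step D (x ∷ xs , ds) _        = length-∷ʳ ds x

length-dealtAfter : (∀ s → s < t → deckAfter P N s ≢ []) →
  length (dealtAfter P N t) ≡ countD P t
length-dealtAfter {zero}          _        = refl
length-dealtAfter {suc t} {P} {N} nonempty = begin
  length (dealtAfter P N (suc t))           ≡⟨ length-dealt-step (P t) (stateAfter P N t) (nonempty t (n<1+n t)) ⟩
  dCount (P t) + length (dealtAfter P N t)  ≡⟨ cong (dCount (P t) +_) (length-dealtAfter (λ s s<t → nonempty s (m<n⇒m<1+n s<t))) ⟩
  dCount (P t) + countD P t                 ≡⟨ sym (countD-suc P t) ⟩
  countD P (suc t)                          ∎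
  where open ≡-Reasoning

step-U-nonempty : (s : State) → proj₁ s ≢ [] → proj₁ (step U s) ≢ []
step-U-nonempty ([] , ds)          nonempty = nonempty
step-U-nonempty (x ∷ [] , ds)      _        = λ ()
step-U-nonempty (x ∷ y ∷ xs , ds)  _        = λ ()

IsM⇒countD : ∀ {m} → IsM P k m → countD P m ≡ k
IsM⇒countD {P} {k} {m} (empty , nonempty) = begin
  countD P m                                          ≡⟨ sym (length-dealtAfter nonempty) ⟩
  length (dealtAfter P k m)                           ≡⟨ cong (λ deck → length deck + length (dealtAfter P k m)) (sym empty) ⟩
  length (deckAfter P k m) + length (dealtAfter P k m) ≡⟨ length-stateAfter P k m ⟩
  k                                                   ∎
  where open ≡-Reasoning

IsM-last-D : IsM P k (suc t) → P t ≡ D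
IsM-last-D {P} {k} {t} (empty , nonempty) = last-D (P t) empty
  where
  last-D : ∀ l → proj₁ (step l (stateAfter P k t)) ≡ [] → l ≡ D
  last-D U emptyU = contradiction emptyU (step-U-nonempty (stateAfter P k t) (nonempty t ≤-refl))
  last-D D _      = refl

IsM⇒IsD : ∀ {m} → 1 ≤ k → IsM P k m → IsD P k m
IsM⇒IsD {m = zero}  (s≤s z≤n) (() , _)
IsM⇒IsD {m = suc t} _         isM = s≤s z≤n , IsM-last-D isM , IsM⇒countD isM

step-keeps-tail : ∀ l (s : State) {x xs rest} → proj₁ s ≡ (x ∷ xs) ++ rest →
  ∃[ rest′ ] proj₁ (step l s) ≡ xs ++ rest′
step-keeps-tail U (_ , ds) {x} {xs} {rest} refl = rest ++ [ x ] , ++-assoc xs rest [ x ]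
step-keeps-tail D (_ , ds) {rest = rest}    refl = rest , refl

deckAfter-untouched : t ≤ N → ∃[ rest ] deckAfter P N t ≡ drop t (initDeck N) ++ rest
deckAfter-untouched {zero}          _   = [] , sym (++-identityʳ _)
deckAfter-untouched {suc t} {N} {P} t<N with deckAfter-untouched {P = P} (<⇒≤ t<N)
... | rest , deck≡ =
  step-keeps-tail (P t) (stateAfter P N t) (trans deck≡ (cong (_++ rest) (drop-initDeck t<N)))

deckAfter-top : t < N → ∃[ rest ] deckAfter P N t ≡ suc t ∷ rest
deckAfter-top {t} {N} {P} t<N with deckAfter-untouched {P = P} (<⇒≤ t<N)
... | rest , deck≡ = drop (suc t) (initDeck N) ++ rest , trans deck≡ (cong (_++ rest) (drop-initDeck t<N))

deckAfter-nonempty : t < N → deckAfter P N t ≢ []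
deckAfter-nonempty {P = P} t<N empty with deckAfter-top {P = P} t<N
... | rest , deck≡ = contradiction (trans (sym deck≡) empty) λ ()

step-D-deals : (s : State) {x : ℕ} {xs : List ℕ} → proj₁ s ≡ x ∷ xs →
  proj₂ (step D s) ≡ proj₂ s ++ [ x ]
step-D-deals (_ , ds) refl = refl

dealtAfter-D : t < N → P t ≡ D → nth (dealtAfter P N (suc t)) (countD P t) ≡ just (suc t)
dealtAfter-D {t} {N} {P} t<N Pt≡D = begin
  nth (dealtAfter P N (suc t)) (countD P t)                         ≡⟨ cong₂ nth dealt≡ (sym (length-dealtAfter earlier-nonempty)) ⟩
  nth (dealtAfter P N t ++ [ suc t ]) (length (dealtAfter P N t))   ≡⟨ nth-∷ʳ (dealtAfter P N t) (suc t) ⟩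
  just (suc t)                                                      ∎
  where
  open ≡-Reasoning
  dealt≡ : dealtAfter P N (suc t) ≡ dealtAfter P N t ++ [ suc t ]
  dealt≡ = trans (cong (λ l → proj₂ (step l (stateAfter P N t))) Pt≡D)
                 (step-D-deals (stateAfter P N t) (proj₂ (deckAfter-top t<N)))
  earlier-nonempty : ∀ s → s < t → deckAfter P N s ≢ []
  earlier-nonempty s s<t = deckAfter-nonempty (<-trans s<t t<N)

IsD⇒IsJ : ∀ {d} → IsD P k d → d ≤ N → IsJ P N k d
IsD⇒IsJ {P} {k} {N} {suc t} (_ , Pt≡D , countD≡k) d≤N = suc t , (begin
  nth (dealtAfter P N (suc t)) (k ∸ 1)                  ≡⟨ cong (λ i → nth (dealtAfter P N (suc t)) (i ∸ 1)) (sym countD≡k) ⟩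
  nth (dealtAfter P N (suc t)) (countD P (suc t) ∸ 1)   ≡⟨ cong (λ i → nth (dealtAfter P N (suc t)) (i ∸ 1)) countD-at-D ⟩
  nth (dealtAfter P N (suc t)) (countD P t)             ≡⟨ dealtAfter-D d≤N Pt≡D ⟩
  just (suc t)                                          ∎)
  where
  open ≡-Reasoning
  countD-at-D : countD P (suc t) ≡ suc (countD P t)
  countD-at-D = trans (countD-suc P t) (cong (λ l → dCount l + countD P t) Pt≡D)

mainTheorem7 : (P : Pattern) → InfinitelyManyD P →
    (k N : ℕ) → 1 ≤ k → 1 ≤ N →
    (m : ℕ) → IsM P k m → m ≤ N →
    IsJ P N k m × IsD P k m
mainTheorem7 P _ k N 1≤k _ m isM m≤N = IsD⇒IsJ isD m≤N , isD
  where
  isD : IsD P k m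
  isD = IsM⇒IsD 1≤k isM
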